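{- Let $G$ be a connected bipartite graph with rank-width $1$ and $|V(G)|\ge 3$, and let $(T,L)$ be a rank-decomposition of $G$ of width $1$. Then every rank-expansion $\boldsymbol{R}(G,T,L,x,\{U_f\}_{f\in E(T)})$ of $G$ with respect to $(T,L)$ is a tree.
   Context: All graphs are finite and simple; $A(G)$ is the adjacency matrix over the binary field $GF(2)$; $M[X,Y]$ is the submatrix with rows $X$ and columns $Y$. In a tree $T$, a leaf is a vertex of degree $1$, other vertices are inner; $V_I(T)$ is the set of inner vertices, $E_I(T)$ the set of edges with no leaf as an end, and $\delta(v)$ the set of edges incident with $v$. A tree is subcubic if it has at least two vertices and every inner vertex has degree $3$. A rank-decomposition of $G$ is a pair $(T,L)$ with $T$ subcubic and $L$ a bijection from $V(G)$ to the leaves of $T$; the width of an edge $e$ is the rank of $A(G)[L^{ -1}(X_e),V(G)\setminus L^{ -1}(X_e)]$ where $X_e$ is the leaf set of a component of $T\setminus e$; the width of $(T,L)$ is the maximum edge width, and the rank-width of $G$ is the minimum width of a rank-decomposition. Rank-expansion: let $(T,L)$ be a rank-decomposition of $G$ and $x$ a leaf of $T$; orient every edge of $T$ away from $x$. For $e\in E(T)$ let $T_e$ be the component of $T\setminus e$ not containing $x$, $A_e=L^{ -1}(V(T_e))$, $B_e=V(G)\setminus A_e$, $M_e=A(G)[A_e,B_e]$. Choose sets $U_e\subseteq A_e$ ($e\in E(T)$) such that (i) the rows of $M_e$ indexed by $U_e$ form a basis of the row space of $M_e$, and (ii) $U_e\cap A_f\subseteq U_f$ whenever the head of $e$ is the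 tail of $f$. Let $P_e$ be the unique $A_e\times U_e$ matrix over $GF(2)$ with $P_eA(G)[U_e,B_e]=A(G)[A_e,B_e]$. If the tail of $f$ is the head of $e$, let $C_f=P_e[U_f,U_e]$. The rank-expansion $\boldsymbol{R}(G,T,L,x,\{U_f\})$ is the graph with vertex set $\bigcup_{v\in V_I(T)}S_v$, where $S_v=\bigcup_{e\in\delta(v)}U_e\times\{e\}\times\{v\}$, and edges: (a) $(a,e,v)(a,e,w)$ for every $e=vw\in E_I(T)$ and $a\in U_e$; (b) $(b,e,v)(a,f,v)$ whenever $v\in V_I(T)$ is the head of $e$ and the tail of $f$, $a\in U_f$, $b\in U_e$ and $(C_f)_{a,b}\ne 0$; (c) $(a,f_1,v)(b,f_2,v)$ whenever $v$ is the tail of two distinct edges $f_1,f_2$, $a\in U_{f_1}$, $b\in U_{f_2}$ and $ab\in E(G)$. A rank-expansion with respect to $(T,L)$ is any graph obtained this way for some leaf $x$ and admissible sets $U_f$. -}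

module Defs where

open import Data.Nat using (ℕ; zero; suc; _≤_; _+_)
open import Data.Fin using (Fin; zero; suc)
open import Data.Bool using (Bool; true; false; _∧_; _xor_; if_then_else_)
open import Data.Product using (Σ; ∃; _×_; _,_)
open import Data.Sum using (_⊎_)
open import Data.Unit using (⊤)
open import Data.List using (List; []; _∷_; _++_)
open import Data.List.Relation.Unary.All using (All)
open import Data.List.Relation.Unary.Unique.Propositional using (Unique)
open import Relation.Nullary using (¬_)
open import Relation.Binary.PropositionalEquality using (_≡_; _≢_)

xorΣ : ∀ {n} → (Fin n → Bool) → Bool
xorΣ {zero}  f = false
xorΣ {suc n} f = f zero xor xorΣ (λ i → f (suc i))

countΣ : ∀ {n} → (Fin n → Bool) → ℕ
countΣ {zero}  f = 0
countΣ {suc n} f = (if f zero then 1 else 0) + countΣ (λ i → f (suc i))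

data Walk {V : Set} (E : V → V → Set) : V → V → Set where
  here : ∀ {u} → Walk E u u
  step : ∀ {u v w} → E u v → Walk E v w → Walk E u w

Path : {V : Set} → (V → V → Set) → List V → Set
Path E []            = ⊤
Path E (u ∷ [])      = ⊤
Path E (u ∷ v ∷ vs)  = E u v × Path E (v ∷ vs)

module _ {V : Set} (InV : V → Set) (E : V → V → Set) where

  Edge : V → V → Set
  Edge u v = InV u × InV v × E u v

  IsConnected : Set
  IsConnected = ∀ u v → InV u → InV v → Walk Edge u v

  HasCycle : Set
  HasCycle = Σ V λ v0 → Σ V λ v1 → Σ V λ v2 → Σ (List V) λ rest →
    Unique (v0 ∷ v1 ∷ v2 ∷ rest) × All InV (v0 ∷ v1 ∷ v2 ∷ rest) ×
    Path Edge ((v0 ∷ v1 ∷ v2 ∷ rest) ++ (v0 ∷ []))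

  IsTree : Set
  IsTree = (Σ V InV) × IsConnected × ¬ HasCycle

record Graph (n : ℕ) : Set where
  field
    adj    : Fin n → Fin n → Bool
    sym    : ∀ u v → adj u v ≡ adj v u
    irrefl : ∀ v → adj v v ≡ false
open Graph public

AllV : ∀ {n} → Fin n → Set
AllV _ = ⊤

Adj : ∀ {n} → Graph n → Fin n → Fin n → Set
Adj G u v = adj G u v ≡ true

Connected : ∀ {n} → Graph n → Set
Connected G = IsConnected AllV (Adj G)

IsTreeG : ∀ {n} → Graph n → Set
IsTreeG G = IsTree AllV (Adj G)

Bipartite : ∀ {n} → Graph n → Set
Bipartite {n} G = Σ (Fin n → Bool) λ c → ∀ u v → Adj G u v → c u ≢ c v

deg : ∀ {m} → Graph m → Fin m → ℕ
deg T v = countΣ (adj T v)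

Leaf : ∀ {m} → Graph m → Fin m → Set
Leaf T v = deg T v ≡ 1

Inner : ∀ {m} → Graph m → Fin m → Set
Inner T v = ¬ Leaf T v

Subcubic : ∀ {m} → Graph m → Set
Subcubic {m} T = IsTreeG T × 2 ≤ m × (∀ v → Inner T v → deg T v ≡ 3)

AdjMinus : ∀ {m} → Graph m → Fin m → Fin m → Fin m → Fin m → Set
AdjMinus T t h u w = Adj T u w × ¬ ((u ≡ t × w ≡ h) ⊎ (u ≡ h × w ≡ t))

-- u lies in the component of T \ th containing h
InSide : ∀ {m} → Graph m → Fin m → Fin m → Fin m → Set
InSide T t h u = Walk (AdjMinus T t h) h u

-- A-side (as a set of vertices of G) of the edge th: L⁻¹ of the leaves in
-- the component of T \ th containing h; the B-side is its complement
ASide : ∀ {n m} → Graph m → (Fin n → Fin m) → Fin m → Fin m → Fin n → Set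
ASide T L t h a = InSide T t h (L a)

BSide : ∀ {n m} → Graph m → (Fin n → Fin m) → Fin m → Fin m → Fin n → Set
BSide T L t h a = ¬ ASide T L t h a

-- GF(2)-rank of A(G)[X,Y]: rank ≤ k iff the rows lie in the span of k vectors

RankLE : ∀ {n} → Graph n → (Fin n → Set) → (Fin n → Set) → ℕ → Set
RankLE {n} G X Y k =
  Σ (Fin k → Fin n → Bool) λ w → ∀ a → X a →
    Σ (Fin k → Bool) λ coef → ∀ c → Y c → adj G a c ≡ xorΣ (λ i → coef i ∧ w i c)

RankIs : ∀ {n} → Graph n → (Fin n → Set) → (Fin n → Set) → ℕ → Set
RankIs G X Y k = RankLE G X Y k × (∀ j → RankLE G X Y j → k ≤ j)

record RankDecomp {n} (G : Graph n) : Set where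
  field
    m        : ℕ
    T        : Graph m
    L        : Fin n → Fin m
    subcubic : Subcubic T
    L-inj    : ∀ a b → L a ≡ L b → a ≡ b
    L-leaf   : ∀ a → Leaf T (L a)
    L-onto   : ∀ v → Leaf T v → Σ (Fin n) λ a → L a ≡ v

-- every edge th of T has width ≤ k (both orientations are quantified over;
-- the width is symmetric anyway)
WidthLE : ∀ {n} {G : Graph n} → RankDecomp G → ℕ → Set
WidthLE {G = G} D k = ∀ t h → Adj T t h →
    Σ ℕ λ r → RankIs G (ASide T L t h) (BSide T L t h) r × r ≤ k
  where open RankDecomp D

WidthIs : ∀ {n} {G : Graph n} → RankDecomp G → ℕ → Set
WidthIs D k = WidthLE D k × (∀ j → WidthLE D j → k ≤ j)

RankWidthIs : ∀ {n} → Graph n → ℕ → Set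
RankWidthIs G k =
  (Σ (RankDecomp G) λ D → WidthIs D k) × (∀ D j → WidthIs {G = G} D j → k ≤ j)

-- Rank-expansions
-- An edge e of T oriented away from the leaf x is represented by the pair
-- (t , h) = (tail , head).  The families U_e and P_e are given as
-- U t h : Fin n → Bool  (membership in U_e) and
-- P t h a b  (the entry (a,b) of P_e, a ∈ A_e, b ∈ U_e).

module _ {n m} (G : Graph n) (T : Graph m) (L : Fin n → Fin m) (x : Fin m) where

  -- th is an edge of T oriented away from x (x ∉ T_e)
  Away : Fin m → Fin m → Set
  Away t h = Adj T t h × ¬ InSide T t h x

  Admissible : (Fin m → Fin m → Fin n → Bool) → Set
  Admissible U =
    (∀ t h → Away t h →
      (∀ a → U t h a ≡ true → ASide T L t h a) ×
      -- (i) rows of M_e indexed by U_e span the row space of M_e ...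
      (∀ a → ASide T L t h a → Σ (Fin n → Bool) λ S →
          (∀ b → S b ≡ true → U t h b ≡ true) ×
          (∀ c → BSide T L t h c → adj G a c ≡ xorΣ (λ b → S b ∧ adj G b c))) ×
      -- ... and are linearly independent over GF(2)
      (∀ (S : Fin n → Bool) → (∀ b → S b ≡ true → U t h b ≡ true) →
          (∀ c → BSide T L t h c → xorΣ (λ b → S b ∧ adj G b c) ≡ false) →
          ∀ b → S b ≡ false)) ×
    (∀ t h h' → Away t h → Away h h' →
      ∀ a → U t h a ≡ true → ASide T L h h' a → U h h' a ≡ true)

  -- P_e A(G)[U_e,B_e] = A(G)[A_e,B_e]
  IsPMatrix : (Fin m → Fin m → Fin n → Bool) → (Fin m → Fin m → Fin n → Fin n → Bool) → Set
  IsPMatrix U P = ∀ t h → Away t h → ∀ a → ASide T L t h a → ∀ c → BSide T L t h c →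
    adj G a c ≡ xorΣ (λ b → U t h b ∧ P t h a b ∧ adj G b c)

  -- candidate vertex (a, e, v) with e = (tail , head)
  record RVert : Set where
    constructor rv
    field
      a    : Fin n
      tail : Fin m
      head : Fin m
      v    : Fin m

  module _ (U : Fin m → Fin m → Fin n → Bool) (P : Fin m → Fin m → Fin n → Fin n → Bool) where

    InR : RVert → Set
    InR (rv a t h v) = Inner T v × Away t h × (v ≡ t ⊎ v ≡ h) × U t h a ≡ true

    RawEdge : RVert → RVert → Set
    RawEdge (rv a t h v) (rv a' t' h' v') =
      (a ≡ a' × t ≡ t' × h ≡ h' × v ≢ v') ⊎
      -- (b): (b,e,v)(a',f,v), v = head e = tail f, (C_f)_{a',b} = P_e[a',b] ≠ 0
      (v ≡ v' × h ≡ v × t' ≡ v × P t h a' a ≡ true) ⊎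
      (v ≡ v' × t ≡ v × t' ≡ v × h ≢ h' × Adj G a a')

    REdge : RVert → RVert → Set
    REdge p q = RawEdge p q ⊎ RawEdge q p

    RankExpansionIsTree : Set
    RankExpansionIsTree = IsTree InR REdge

module Submission where

-- Width 1 makes every U_e a singleton {u_e}, and P_e then says: for a ∈ A_e,
-- c ∈ B_e, a ~ c iff P_e[a,u_e] = 1 and u_e ~ c.  Call an outgoing copy
-- (u_f,f,v) of the block S_v "selected" if P_e[u_f,u_e] = 1 for the edge e
-- entering v.  Selected copies hang from (u_e,e,v) by (b)-edges; at least one
-- of the two outgoing copies is selected; an unselected one is joined by a
-- (c)-edge to the other; two selected ones are not G-adjacent (no triangle).
-- So every vertex except the root (u_{xv₀},xv₀,v₀) has a parent neighbour,
-- a potential Ψ increases towards parents, and every edge is a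
-- (child, parent) pair; such a graph is a tree (module PotentialTree).

open import Defs hiding (sym; irrefl; Away)
open import Defs using () renaming (sym to adj-sym; irrefl to adj-irrefl)
open import Algebra.Bundles using (CommutativeRing)
open import Data.Bool using (Bool; true; false; _∧_; _xor_; not; if_then_else_)
open import Data.Bool.Properties
  using (xor-same; xor-identityʳ; ∧-distribʳ-xor; ∧-conicalˡ; ∧-conicalʳ; ¬-not; xor-∧-commutativeRing)
  renaming (_≟_ to _≟B_)
open import Algebra.Properties.CommutativeSemigroup
  (CommutativeRing.+-commutativeSemigroup xor-∧-commutativeRing) using (interchange)
open import Data.Empty using (⊥; ⊥-elim)
open import Data.Fin using (Fin; zero; suc) renaming (_≟_ to _≟F_)
open import Data.Fin.Properties using (any?)
open import Data.List using (List; []; _∷_; _++_)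
open import Data.List.Relation.Unary.All as All using (All; []; _∷_)
open import Data.List.Relation.Unary.AllPairs using ([]; _∷_)
open import Data.List.Relation.Unary.Unique.Propositional using (Unique)
open import Data.Nat using (ℕ; zero; suc; _≤_; _<_; _+_; _*_; z≤n; s≤s) renaming (_≟_ to _≟ℕ_)
open import Data.Nat.Properties
open import Data.Product using (Σ; _×_; _,_; proj₁; proj₂)
open import Data.Sum using (_⊎_; inj₁; inj₂; [_,_]′) renaming (map to ⊎-map; swap to ⊎-swap)
open import Data.Unit using (⊤; tt)
open import Function using (_∘_; case_of_)
open import Relation.Binary.PropositionalEquality
open import Relation.Nullary using (¬_; Dec; yes; no)
open import Relation.Nullary.Decidable using (_×-dec_; _⊎-dec_; ¬?)

true≢false : true ≢ false
true≢false ()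

-- Three Booleans are never pairwise distinct (a 2-colouring has no triangle).
noThreeDistinct : (a b c : Bool) → a ≢ c → b ≢ c → a ≢ b → ⊥
noThreeDistinct true  true  _     _  _  ab = ab refl
noThreeDistinct false false _     _  _  ab = ab refl
noThreeDistinct true  false true  ac _  _  = ac refl
noThreeDistinct true  false false _  bc _  = bc refl
noThreeDistinct false true  true  _  bc _  = bc refl
noThreeDistinct false true  false ac _  _  = ac refl

δ : ∀ {n} → Fin n → Fin n → Bool
δ zero    zero    = true
δ zero    (suc _) = false
δ (suc _) zero    = false
δ (suc i) (suc j) = δ i j

δ-refl : ∀ {n} (i : Fin n) → δ i i ≡ true
δ-refl zero    = refl
δ-refl (suc i) = δ-refl i

δ-true : ∀ {n} {i j : Fin n} → δ i j ≡ true → i ≡ j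
δ-true {i = zero}  {zero}  _ = refl
δ-true {i = suc i} {suc j} e = cong suc (δ-true e)

δ-false : ∀ {n} {i j : Fin n} → i ≢ j → δ i j ≡ false
δ-false ne = ¬-not (ne ∘ δ-true)

xorΣ-cong : ∀ {n} {f g : Fin n → Bool} → (∀ i → f i ≡ g i) → xorΣ f ≡ xorΣ g
xorΣ-cong {zero}  h = refl
xorΣ-cong {suc n} h = cong₂ _xor_ (h zero) (xorΣ-cong (h ∘ suc))

xorΣ-zero : ∀ {n} (f : Fin n → Bool) → (∀ i → f i ≡ false) → xorΣ f ≡ false
xorΣ-zero {zero}  f h = refl
xorΣ-zero {suc n} f h rewrite h zero = xorΣ-zero (f ∘ suc) (h ∘ suc)

xorΣ-witness : ∀ {n} (f : Fin n → Bool) → xorΣ f ≡ true → Σ (Fin n) λ i → f i ≡ true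
xorΣ-witness {suc n} f e with f zero in eq
... | true  = zero , eq
... | false = let (i , p) = xorΣ-witness (f ∘ suc) e in suc i , p

xorΣ-δ : ∀ {n} (i : Fin n) (g : Fin n → Bool) → xorΣ (λ b → δ i b ∧ g b) ≡ g i
xorΣ-δ {suc n} zero g
  rewrite xorΣ-zero {n} (λ _ → false) (λ _ → refl) = xor-identityʳ (g zero)
xorΣ-δ {suc n} (suc i) g = xorΣ-δ i (g ∘ suc)

xorΣ-xor : ∀ {n} (f g : Fin n → Bool) → xorΣ (λ b → f b xor g b) ≡ xorΣ f xor xorΣ g
xorΣ-xor {zero}  f g = refl
xorΣ-xor {suc n} f g =
  trans (cong ((f zero xor g zero) xor_) (xorΣ-xor (f ∘ suc) (g ∘ suc)))
        (interchange (f zero) (g zero) _ _)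

without : ∀ {n} → (Fin n → Bool) → Fin n → Fin n → Bool
without f i j = not (δ i j) ∧ f j

without-same : ∀ {n} (f : Fin n → Bool) i → without f i i ≡ false
without-same f i rewrite δ-refl i = refl

without-other : ∀ {n} (f : Fin n → Bool) {i j} → j ≢ i → without f i j ≡ f j
without-other f ne rewrite δ-false (ne ∘ sym) = refl

without-⊆ : ∀ {n} (f : Fin n → Bool) i j → without f i j ≡ true → f j ≡ true
without-⊆ f i j = ∧-conicalʳ (not (δ i j)) (f j)

without-≢ : ∀ {n} (f : Fin n → Bool) i {j} → without f i j ≡ true → j ≢ i
without-≢ f i w refl = true≢false (trans (sym w) (without-same f i))

countΣ-without : ∀ {n} (f : Fin n → Bool) i → f i ≡ true → countΣ f ≡ suc (countΣ (without f i))
countΣ-without {suc n} f zero    fi rewrite fi = refl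
countΣ-without {suc n} f (suc i) fi =
  trans (cong ((if f zero then 1 else 0) +_) (countΣ-without (f ∘ suc) i fi))
        (+-suc (if f zero then 1 else 0) _)

countΣ-witness : ∀ {n} (f : Fin n → Bool) {k} → countΣ f ≡ suc k → Σ (Fin n) λ i → f i ≡ true
countΣ-witness {suc n} f e with f zero in eq
... | true  = zero , eq
... | false = let (i , p) = countΣ-witness (f ∘ suc) e in suc i , p

countΣ-zero : ∀ {n} (f : Fin n → Bool) → countΣ f ≡ 0 → ∀ i → f i ≡ false
countΣ-zero f e i = ¬-not λ fi → case trans (sym (countΣ-without f i fi)) e of λ ()

countΣ-one : ∀ {n} (f : Fin n → Bool) → countΣ f ≡ 1 →
  ∀ {i j} → f i ≡ true → f j ≡ true → i ≡ j
countΣ-one f e {i} {j} fi fj with i ≟F j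
... | yes p = p
... | no ne = ⊥-elim (true≢false (trans (sym (trans (without-other f (ne ∘ sym)) fj))
                (countΣ-zero (without f i) (suc-injective (trans (sym (countΣ-without f i fi)) e)) j)))

countΣ-three : ∀ {n} (f : Fin n → Bool) → countΣ f ≡ 3 → ∀ {i j} → f i ≡ true → f j ≡ true → i ≢ j →
  Σ (Fin n) λ k → f k ≡ true × k ≢ i × k ≢ j × (∀ l → f l ≡ true → l ≡ i ⊎ l ≡ j ⊎ l ≡ k)
countΣ-three f e {i} {j} fi fj i≢j =
  k , without-⊆ f i k (without-⊆ f₁ j k f₂k) , without-≢ f i (without-⊆ f₁ j k f₂k) ,
  without-≢ f₁ j f₂k , onlyThree
  where
  f₁ f₂ : Fin _ → Bool
  f₁ = without f i
  f₂ = without f₁ j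
  f₁j : f₁ j ≡ true
  f₁j = trans (without-other f (i≢j ∘ sym)) fj
  count₂ : countΣ f₂ ≡ 1
  count₂ = suc-injective (trans (sym (countΣ-without f₁ j f₁j))
             (suc-injective (trans (sym (countΣ-without f i fi)) e)))
  k : Fin _
  k = proj₁ (countΣ-witness f₂ count₂)
  f₂k : f₂ k ≡ true
  f₂k = proj₂ (countΣ-witness f₂ count₂)
  onlyThree : ∀ l → f l ≡ true → l ≡ i ⊎ l ≡ j ⊎ l ≡ k
  onlyThree l fl with l ≟F i | l ≟F j
  ... | yes p | _     = inj₁ p
  ... | no _  | yes q = inj₂ (inj₁ q)
  ... | no p  | no q  = inj₂ (inj₂ (countΣ-one f₂ count₂
          (trans (without-other f₁ q) (trans (without-other f p) fl)) f₂k))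

countΣ-≤ : ∀ {n} (f : Fin n → Bool) → countΣ f ≤ n
countΣ-≤ {zero}  f = z≤n
countΣ-≤ {suc n} f with f zero
... | true  = s≤s (countΣ-≤ (f ∘ suc))
... | false = m≤n⇒m≤1+n (countΣ-≤ (f ∘ suc))

countΣ-mono : ∀ {n} (f g : Fin n → Bool) → (∀ i → f i ≡ true → g i ≡ true) → countΣ f ≤ countΣ g
countΣ-mono {zero}  f g h = z≤n
countΣ-mono {suc n} f g h with f zero in e₁ | g zero in e₂
... | true  | true  = s≤s (countΣ-mono _ _ (h ∘ suc))
... | true  | false = ⊥-elim (true≢false (trans (sym (h zero e₁)) e₂))
... | false | true  = m≤n⇒m≤1+n (countΣ-mono _ _ (h ∘ suc))
... | false | false = countΣ-mono _ _ (h ∘ suc)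

countΣ-strict : ∀ {n} (f g : Fin n → Bool) → (∀ i → f i ≡ true → g i ≡ true) →
  ∀ j → f j ≡ false → g j ≡ true → countΣ f < countΣ g
countΣ-strict {suc n} f g h zero fj gj rewrite fj | gj = s≤s (countΣ-mono _ _ (h ∘ suc))
countΣ-strict {suc n} f g h (suc j) fj gj with f zero in e₁ | g zero in e₂
... | true  | true  = s≤s (countΣ-strict _ _ (h ∘ suc) j fj gj)
... | true  | false = ⊥-elim (true≢false (trans (sym (h zero e₁)) e₂))
... | false | true  = m<n⇒m<1+n (countΣ-strict _ _ (h ∘ suc) j fj gj)
... | false | false = countΣ-strict _ _ (h ∘ suc) j fj gj

noInjectionIntoPair : ∀ {n m} {a b : Fin m} → 3 ≤ n → (g : Fin n → Fin m) →
  (∀ i → g i ≡ a ⊎ g i ≡ b) → (∀ i j → g i ≡ g j → i ≡ j) → ⊥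
noInjectionIntoPair {suc (suc (suc n))} (s≤s (s≤s (s≤s _))) g two inj
  with two zero | two (suc zero) | two (suc (suc zero))
... | inj₁ e₀ | inj₁ e₁ | _       = case inj zero (suc zero) (trans e₀ (sym e₁)) of λ ()
... | inj₂ e₀ | inj₂ e₁ | _       = case inj zero (suc zero) (trans e₀ (sym e₁)) of λ ()
... | inj₁ e₀ | inj₂ e₁ | inj₁ e₂ = case inj zero (suc (suc zero)) (trans e₀ (sym e₂)) of λ ()
... | inj₁ e₀ | inj₂ e₁ | inj₂ e₂ = case inj (suc zero) (suc (suc zero)) (trans e₁ (sym e₂)) of λ ()
... | inj₂ e₀ | inj₁ e₁ | inj₂ e₂ = case inj zero (suc (suc zero)) (trans e₀ (sym e₂)) of λ ()
... | inj₂ e₀ | inj₁ e₁ | inj₁ e₂ = case inj (suc zero) (suc (suc zero)) (trans e₁ (sym e₂)) of λ ()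

module Walks {V : Set} where

  _▷_ : ∀ {R : V → V → Set} {u v w} → Walk R u v → R v w → Walk R u w
  here       ▷ e = step e here
  step e′ r ▷ e  = step e′ (r ▷ e)

  _++ʷ_ : ∀ {R : V → V → Set} {u v w} → Walk R u v → Walk R v w → Walk R u w
  here     ++ʷ q = q
  step e r ++ʷ q = step e (r ++ʷ q)

  reverse : ∀ {R : V → V → Set} → (∀ {a b} → R a b → R b a) → ∀ {u v} → Walk R u v → Walk R v u
  reverse s here       = here
  reverse s (step e r) = reverse s r ▷ s e

  mapʷ : ∀ {R R′ : V → V → Set} → (∀ {a b} → R a b → R′ a b) → ∀ {u v} → Walk R u v → Walk R′ u v
  mapʷ f here       = here
  mapʷ f (step e r) = step (f e) (mapʷ f r)

  inner : ∀ {R : V → V → Set} {u v} → Walk R u v → List V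
  inner here                = []
  inner (step {v = v} e r) = v ∷ inner r

  vertices : ∀ {R : V → V → Set} {u v} → Walk R u v → List V
  vertices {u = u} w = u ∷ inner w

module SimpleWalks {V : Set} (_≟_ : (a b : V) → Dec (a ≡ b)) (R : V → V → Set) where
  open Walks {V}

  SimpleWalk : V → V → Set
  SimpleWalk a b = Σ (Walk R a b) λ w → Unique (vertices w)

  suffixFrom : ∀ z {a v} (w : Walk R a v) → Unique (vertices w) →
    SimpleWalk z v ⊎ All (z ≢_) (vertices w)
  suffixFrom z {a} here u with z ≟ a
  ... | yes refl = inj₁ (here , u)
  ... | no ne    = inj₂ (ne ∷ [])
  suffixFrom z {a} (step e r) u with z ≟ a
  ... | yes refl = inj₁ (step e r , u)
  suffixFrom z {a} (step e r) (_ ∷ u) | no ne with suffixFrom z r u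
  ... | inj₁ p = inj₁ p
  ... | inj₂ q = inj₂ (ne ∷ q)

  simplify : ∀ {a v} → Walk R a v → SimpleWalk a v
  simplify here = here , ([] ∷ [])
  simplify {a} (step e r) with simplify r
  ... | r′ , ur with suffixFrom a r′ ur
  ... | inj₁ p = p
  ... | inj₂ q = step e r′ , (q ∷ ur)

-- A graph in which every edge joins a vertex to its parent, with a
-- potential increasing towards the parent, is a tree as soon as every
-- vertex other than a root can climb to its parent.

module PotentialTree {V : Set} (InV : V → Set) (E : V → V → Set) (Ψ : V → ℕ) (par : V → V) where
  open Walks {V}

  Ed : V → V → Set
  Ed = Edge InV E

  ToParent : V → V → Set
  ToParent y z = Ψ y < Ψ z × z ≡ par y

  ParentEdges : Set
  ParentEdges = ∀ y z → Ed y z → ToParent y z ⊎ ToParent z y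

  NoBacktrack : List V → Set
  NoBacktrack (a ∷ b ∷ c ∷ l) = a ≢ c × NoBacktrack (b ∷ c ∷ l)
  NoBacktrack _               = ⊤

  LastAscends : List V → Set
  LastAscends (a ∷ b ∷ [])    = ToParent a b
  LastAscends (a ∷ b ∷ c ∷ l) = LastAscends (b ∷ c ∷ l)
  LastAscends _               = ⊤

  module _ (parentEdges : ParentEdges) where

    -- A non-backtracking walk that starts by descending keeps descending
    -- (a vertex has only one parent), so Ψ stays below its start.
    descending : ∀ a b l → Path Ed (a ∷ b ∷ l) → NoBacktrack (a ∷ b ∷ l) → ToParent b a →
      All (λ z → Ψ z < Ψ a) (b ∷ l)
    descending a b []      p nb (lt , _) = lt ∷ []
    descending a b (c ∷ l) (_ , p) (a≢c , nb) (lt , a≡pb) with parentEdges b c (proj₁ p)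
    ... | inj₁ (_ , c≡pb) = ⊥-elim (a≢c (trans a≡pb (sym c≡pb)))
    ... | inj₂ down       = lt ∷ All.map (λ q → <-trans q lt) (descending b c l p nb down)

    -- Dually, one that ends by ascending has ascended all along.
    ascending : ∀ a b l → Path Ed (a ∷ b ∷ l) → NoBacktrack (a ∷ b ∷ l) → LastAscends (a ∷ b ∷ l) →
      ToParent a b × All (λ z → Ψ a < Ψ z) (b ∷ l)
    ascending a b []      p nb up = up , (proj₁ up ∷ [])
    ascending a b (c ∷ l) (e , p) (a≢c , nb) up with ascending b c l p nb up | parentEdges a b e
    ... | (_ , above) | inj₁ ab = ab , (proj₁ ab ∷ All.map (<-trans (proj₁ ab)) above)
    ... | (up′ , _) | inj₂ (_ , a≡pb) = ⊥-elim (a≢c (trans a≡pb (sym (proj₂ up′))))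

    private
      lastAscends-++ : ∀ {a b} l → ToParent a b → LastAscends (l ++ a ∷ b ∷ [])
      lastAscends-++ []               u = u
      lastAscends-++ (z ∷ [])         u = u
      lastAscends-++ (z ∷ z′ ∷ [])     u = u
      lastAscends-++ (z ∷ z′ ∷ c ∷ l) u = lastAscends-++ (z′ ∷ c ∷ l) u

      path-▷ : ∀ {a b} l → Path Ed (l ++ a ∷ []) → Ed a b → Path Ed (l ++ a ∷ b ∷ [])
      path-▷ []           p e = e , tt
      path-▷ (z ∷ [])     (e′ , p) e = e′ , e , tt
      path-▷ (z ∷ z′ ∷ l) (e′ , p) e = e′ , path-▷ (z′ ∷ l) p e

      all-at : ∀ {P : V → Set} {a} l r → All P (l ++ a ∷ r) → P a
      all-at []      r (p ∷ _)  = p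
      all-at (z ∷ l) r (_ ∷ ps) = all-at l r ps

      noBacktrack-cycle : ∀ {w₀ w₁} a b r → Unique (a ∷ b ∷ r) → All (w₀ ≢_) (a ∷ b ∷ r) →
        All (w₁ ≢_) (b ∷ r) → NoBacktrack ((a ∷ b ∷ r) ++ w₀ ∷ w₁ ∷ [])
      noBacktrack-cycle a b []      u (w₀≢a ∷ w₀≢b ∷ []) (w₁≢b ∷ []) = w₀≢a ∘ sym , w₁≢b ∘ sym , tt
      noBacktrack-cycle a b (c ∷ r) ((_ ∷ a≢c ∷ _) ∷ u) (_ ∷ w₀≢) (_ ∷ w₁≢) =
        a≢c , noBacktrack-cycle b c r u w₀≢ w₁≢

    -- Walking around a cycle v₀ v₁ … v₀ v₁ either always descends or always
    -- ascends; in both cases Ψ v₀ < Ψ v₀.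
    acyclic : ¬ HasCycle InV E
    acyclic (v₀ , v₁ , v₂ , rest , u@((v₀≢v₁ ∷ v₀≢v₂ ∷ v₀≢r) ∷ u₁@((v₁≢v₂ ∷ v₁≢r) ∷ _)) , _ , p) =
      [ goingUp , goingDown ]′ (parentEdges v₀ v₁ (proj₁ p))
      where
      cycle : List V
      cycle = v₀ ∷ v₁ ∷ v₂ ∷ rest
      around : Path Ed (cycle ++ v₀ ∷ v₁ ∷ [])
      around = path-▷ cycle p (proj₁ p)
      noBacktrack : NoBacktrack (cycle ++ v₀ ∷ v₁ ∷ [])
      noBacktrack = v₀≢v₂ , noBacktrack-cycle v₁ v₂ rest u₁ (v₀≢v₁ ∷ v₀≢v₂ ∷ v₀≢r) (v₁≢v₂ ∷ v₁≢r)
      goingDown : ToParent v₁ v₀ → ⊥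
      goingDown d = <-irrefl refl (all-at {P = λ z → Ψ z < Ψ v₀} (v₁ ∷ v₂ ∷ rest) (v₁ ∷ [])
                      (descending v₀ v₁ (v₂ ∷ rest ++ v₀ ∷ v₁ ∷ []) around noBacktrack d))
      goingUp : ToParent v₀ v₁ → ⊥
      goingUp up = <-irrefl refl (all-at {P = λ z → Ψ v₀ < Ψ z} (v₁ ∷ v₂ ∷ rest) (v₁ ∷ [])
                      (proj₂ (ascending v₀ v₁ (v₂ ∷ rest ++ v₀ ∷ v₁ ∷ []) around noBacktrack
                         (lastAscends-++ cycle up))))

  Climbs : V → Set
  Climbs root = ∀ y → InV y → y ≡ root ⊎ Σ V λ z → InV z × E y z × ToParent y z

  walkToRoot : ∀ {root} B → (∀ y → Ψ y < B) → Climbs root → ∀ k y → InV y → B ≤ k + Ψ y → Walk Ed y root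
  walkToRoot B bound climb zero    y iy le = ⊥-elim (<⇒≱ (bound y) le)
  walkToRoot B bound climb (suc k) y iy le with climb y iy
  ... | inj₁ refl = here
  ... | inj₂ (z , iz , e , lt , _) = step (iy , iz , e) (walkToRoot B bound climb k z iz
          (≤-trans le (≤-trans (≤-reflexive (sym (+-suc k (Ψ y)))) (+-monoʳ-≤ k lt))))

  potentialTree : (∀ {y z} → E y z → E z y) → ∀ root → InV root → ∀ B → (∀ y → Ψ y < B) →
    Climbs root → ParentEdges → IsTree InV E
  potentialTree E-sym root inRoot B bound climb parentEdges =
    (root , inRoot) ,
    (λ u w iu iw → toRoot u iu ++ʷ reverse Ed-sym (toRoot w iw)) ,
    acyclic parentEdges
    where
    toRoot : ∀ y → InV y → Walk Ed y root
    toRoot y iy = walkToRoot B bound climb B y iy (m≤m+n B (Ψ y))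
    Ed-sym : ∀ {a b} → Ed a b → Ed b a
    Ed-sym (ia , ib , e) = ib , ia , E-sym e

-- For an edge th, the
-- h-side of th is the component of T \ th containing h; "th is away"
-- means that x is not on the h-side, i.e. th points away from x.

module OrientedTree {m} (T : Graph m) (connT : IsConnected AllV (Adj T))
  (acyclicT : ¬ HasCycle AllV (Adj T)) (cubic : ∀ v → Inner T v → deg T v ≡ 3)
  (x : Fin m) (leafX : Leaf T x) where

  open Walks {Fin m}

  side : Fin m → Fin m → Fin m → Set
  side = InSide T

  Minus : Fin m → Fin m → Fin m → Fin m → Set
  Minus = AdjMinus T

  T-sym : ∀ {a b} → Adj T a b → Adj T b a
  T-sym {a} {b} e = trans (adj-sym T b a) e

  T-irrefl : ∀ {a} → ¬ Adj T a a
  T-irrefl {a} e = true≢false (trans (sym e) (adj-irrefl T a))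

  IsCut : Fin m → Fin m → Fin m → Fin m → Set
  IsCut t h a b = (a ≡ t × b ≡ h) ⊎ (a ≡ h × b ≡ t)

  isCut? : ∀ t h a b → Dec (IsCut t h a b)
  isCut? t h a b = ((a ≟F t) ×-dec (b ≟F h)) ⊎-dec ((a ≟F h) ×-dec (b ≟F t))

  Minus-sym : ∀ {t h a b} → Minus t h a b → Minus t h b a
  Minus-sym (e , ne) = T-sym e , ne ∘ λ { (inj₁ (p , q)) → inj₂ (q , p) ; (inj₂ (p , q)) → inj₁ (q , p) }

  Minus-flip : ∀ {t h a b} → Minus t h a b → Minus h t a b
  Minus-flip (e , ne) = e , ne ∘ ⊎-swap

  walkPath : ∀ {t h a b c} (w : Walk (Minus t h) a b) → Adj T b c →
    Path (Edge AllV (Adj T)) (vertices w ++ c ∷ [])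
  walkPath here       bc = (tt , tt , bc) , tt
  walkPath (step e r) bc = (tt , tt , proj₁ e) , walkPath r bc

  -- The tail of an edge is not on its head side: otherwise T has a cycle.
  tail∉side : ∀ {t h} → Adj T t h → ¬ side t h t
  tail∉side {t} {h} th s with SimpleWalks.simplify _≟F_ (Minus t h) s
  ... | here , _ = T-irrefl th
  ... | step e here , _ = proj₂ e (inj₂ (refl , refl))
  ... | step {v = p₁} e₁ (step {v = p₂} e₂ w) , u =
        acyclicT (h , p₁ , p₂ , inner w , u , All.universal (λ _ → tt) _ , walkPath (step e₁ (step e₂ w)) th)

  side-cover : ∀ {t h} → Adj T t h → ∀ u → side t h u ⊎ side h t u
  side-cover {t} {h} th u = go (connT h u tt tt) (inj₁ here)
    where
    go : ∀ {s} → Walk (Edge AllV (Adj T)) s u → side t h s ⊎ side h t s → side t h u ⊎ side h t u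
    go here c = c
    go {s} (step {v = s′} (_ , _ , e) r) c with isCut? t h s s′
    ... | yes (inj₁ (_ , refl)) = go r (inj₁ here)
    ... | yes (inj₂ (_ , refl)) = go r (inj₂ here)
    ... | no ne = go r (⊎-map (_▷ (e , ne)) (_▷ (e , ne ∘ ⊎-swap)) c)

  side-disjoint : ∀ {t h u} → Adj T t h → side t h u → side h t u → ⊥
  side-disjoint th w₁ w₂ = tail∉side th (w₁ ++ʷ reverse Minus-sym (mapʷ Minus-flip w₂))

  side? : ∀ {t h} → Adj T t h → ∀ u → Dec (side t h u)
  side? th u with side-cover th u
  ... | inj₁ s  = yes s
  ... | inj₂ s′ = no λ s → side-disjoint th s s′

  avoidOrReach : ∀ {a b s u} → Walk (Minus a b) s u → ∀ c d → Walk (Minus c d) s u ⊎ Walk (Minus a b) s c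
  avoidOrReach here c d = inj₁ here
  avoidOrReach {s = s} (step {v = s′} e r) c d with isCut? c d s s′
  ... | yes (inj₁ (refl , _)) = inj₂ here
  ... | yes (inj₂ (_ , refl)) = inj₂ (step e here)
  ... | no ne with avoidOrReach r c d
  ...   | inj₁ r′ = inj₁ (step (proj₁ e , ne) r′)
  ...   | inj₂ p  = inj₂ (step e p)

  avoiding : ∀ {R : Fin m → Fin m → Set} → (∀ {c d} → R c d → Adj T c d) →
    ∀ {z a b} (w : Walk R a b) → All (z ≢_) (vertices w) → ∀ t → Walk (Minus t z) a b
  avoiding f here _ t = here
  avoiding f (step e r) (z≢a ∷ rest@(z≢a′ ∷ _)) t =
    step (f e , λ { (inj₁ (_ , e′)) → z≢a′ (sym e′) ; (inj₂ (e′ , _)) → z≢a (sym e′) }) (avoiding f r rest t)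

  distinctSides : ∀ {v n₁ n₂ y} → Adj T v n₁ → Adj T v n₂ → n₁ ≢ n₂ → side v n₁ y → side v n₂ y → ⊥
  distinctSides {v} {n₁} {n₂} a₁ a₂ ne s₁ s₂ with avoidOrReach s₁ v n₂
  ... | inj₂ p = tail∉side a₁ p
  ... | inj₁ w = side-disjoint a₂ s₂ (mapʷ Minus-flip (step (a₁ , notCut) w))
    where
    notCut : ¬ IsCut v n₂ v n₁
    notCut (inj₁ (_ , e)) = ne e
    notCut (inj₂ (e , _)) = T-irrefl (subst (Adj T v) (sym e) a₂)

  leaf-neighbour : ∀ {l a b} → Leaf T l → Adj T l a → Adj T l b → a ≡ b
  leaf-neighbour {l} lf = countΣ-one (adj T l) lf

  Away : Fin m → Fin m → Set
  Away t h = Adj T t h × ¬ side t h x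

  Away? : ∀ t h → Dec (Away t h)
  Away? t h with adj T t h ≟B true
  ... | no ¬th = no (¬th ∘ proj₁)
  ... | yes th with side? th x
  ...   | yes s  = no λ aw → proj₂ aw s
  ...   | no ¬s = yes (th , ¬s)

  away-xSide : ∀ {t h} → Away t h → side h t x
  away-xSide (th , ¬s) = [ ⊥-elim ∘ ¬s , (λ s → s) ]′ (side-cover th x)

  away-antisym : ∀ {t h} → Away t h → Away h t → ⊥
  away-antisym a₁ a₂ = proj₂ a₂ (away-xSide a₁)

  parent-unique : ∀ {n₁ n₂ v} → Away n₁ v → Away n₂ v → n₁ ≡ n₂
  parent-unique {n₁} {n₂} a₁ a₂ with n₁ ≟F n₂
  ... | yes e = e
  ... | no ne = ⊥-elim (distinctSides (T-sym (proj₁ a₁)) (T-sym (proj₁ a₂)) ne (away-xSide a₁) (away-xSide a₂))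

  -- ... and every vertex but x has one: the next vertex on the way to x.
  parent-exists : ∀ {v} → v ≢ x → Σ (Fin m) λ p → Away p v
  parent-exists {v} v≢x with SimpleWalks.simplify _≟F_ (Edge AllV (Adj T)) (connT v x tt tt)
  ... | here , _ = ⊥-elim (v≢x refl)
  ... | step {v = w} (_ , _ , vw) r , (v∉r ∷ _) =
        w , T-sym vw , λ s → tail∉side (T-sym vw)
          (s ++ʷ reverse Minus-sym (avoiding (proj₂ ∘ proj₂) r v∉r w))

  parent : Fin m → Fin m
  parent v with any? (λ p → Away? p v)
  ... | yes (p , _) = p
  ... | no _        = v

  parent-spec : ∀ {p v} → Away p v → parent v ≡ p
  parent-spec {p} {v} ap with any? (λ q → Away? q v)
  ... | yes (q , aq) = parent-unique aq ap
  ... | no none      = ⊥-elim (none (p , ap))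

  away-parent : ∀ {v} → v ≢ x → Away (parent v) v
  away-parent v≢x = let (q , aq) = parent-exists v≢x in subst (λ r → Away r _) (sym (parent-spec aq)) aq

  away-from-leaf : ∀ {t h} → Leaf T t → Away t h → t ≡ x
  away-from-leaf {t} {h} lt aw with away-xSide aw
  ... | here     = refl
  ... | step e _ = ⊥-elim (proj₂ e (inj₂ (refl , leaf-neighbour lt (proj₁ e) (proj₁ aw))))

  inner≢x : ∀ {v} → Inner T v → v ≢ x
  inner≢x inn refl = inn leafX

  side-⊆ : ∀ {p t h u} → Away p t → Away t h → side t h u → side p t u
  side-⊆ {p} {t} {h} ap ath s with avoidOrReach s t p
  ... | inj₂ q = ⊥-elim (tail∉side (proj₁ ath) q)
  ... | inj₁ w = step (proj₁ ath , notCut) (mapʷ Minus-flip w)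
    where
    notCut : ¬ IsCut p t t h
    notCut (inj₁ (e , _)) = T-irrefl (subst (λ q → Adj T q t) (sym e) (proj₁ ap))
    notCut (inj₂ (_ , e)) = away-antisym ath (subst (λ q → Away q t) (sym e) ap)

  record Star (v p : Fin m) : Set where
    field
      c₁ c₂     : Fin m
      away₁     : Away v c₁
      away₂     : Away v c₂
      c₁≢c₂     : c₁ ≢ c₂
      neighbours : ∀ w → Adj T v w → w ≡ p ⊎ w ≡ c₁ ⊎ w ≡ c₂

  star : ∀ {v p} → Inner T v → Away p v → Star v p
  star {v} {p} inn ap = fromThird (countΣ-three (adj T v) (cubic v inn) vp vj (without-≢ (adj T v) p vj′ ∘ sym))
    where
    vp : Adj T v p
    vp = T-sym (proj₁ ap)
    two : countΣ (without (adj T v) p) ≡ 2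
    two = suc-injective (trans (sym (countΣ-without (adj T v) p vp)) (cubic v inn))
    j : Fin m
    j = proj₁ (countΣ-witness (without (adj T v) p) two)
    vj′ : without (adj T v) p j ≡ true
    vj′ = proj₂ (countΣ-witness (without (adj T v) p) two)
    vj : Adj T v j
    vj = without-⊆ (adj T v) p j vj′
    away : ∀ c → c ≢ p → Adj T v c → Away v c
    away c c≢p vc = vc , distinctSides vp vc (c≢p ∘ sym) (away-xSide ap)
    fromThird : Σ (Fin m) (λ k → Adj T v k × k ≢ p × k ≢ j × (∀ l → Adj T v l → l ≡ p ⊎ l ≡ j ⊎ l ≡ k)) →
      Star v p
    fromThird (k , vk , k≢p , k≢j , nb) = record
      { c₁ = j ; c₂ = k ; away₁ = away j (without-≢ (adj T v) p vj′) vj ; away₂ = away k k≢p vk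
      ; c₁≢c₂ = k≢j ∘ sym ; neighbours = nb }

  child-of-star : ∀ {v p c} → Away p v → (st : Star v p) → Away v c → c ≡ Star.c₁ st ⊎ c ≡ Star.c₂ st
  child-of-star ap st ac with Star.neighbours st _ (proj₁ ac)
  ... | inj₁ refl = ⊥-elim (away-antisym ap ac)
  ... | inj₂ q    = q

  star-cover : ∀ {p t u} → Away p t → (st : Star t p) → side p t u → u ≢ t →
    side t (Star.c₁ st) u ⊎ side t (Star.c₂ st) u
  star-cover {p} {t} {u} ap st s u≢t with SimpleWalks.simplify _≟F_ (Minus p t) s
  ... | here , _ = ⊥-elim (u≢t refl)
  ... | step {v = w} e r , (t∉r ∷ _) with Star.neighbours st w (proj₁ e)
  ...   | inj₁ refl         = ⊥-elim (proj₂ e (inj₂ (refl , refl)))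
  ...   | inj₂ (inj₁ refl) = inj₁ (mapʷ Minus-flip (avoiding proj₁ r t∉r w))
  ...   | inj₂ (inj₂ refl) = inj₂ (mapʷ Minus-flip (avoiding proj₁ r t∉r w))

  children-cover : ∀ {p t u h₁ h₂} → Away p t → Inner T t → Away t h₁ → Away t h₂ → h₁ ≢ h₂ →
    side p t u → u ≢ t → side t h₁ u ⊎ side t h₂ u
  children-cover {p} {t} {u} {h₁} {h₂} ap inn a₁ a₂ ne s u≢t =
    go (star-cover ap st s u≢t) (child-of-star ap st a₁) (child-of-star ap st a₂)
    where
    st : Star t p
    st = star inn ap
    go : side t (Star.c₁ st) u ⊎ side t (Star.c₂ st) u →
         h₁ ≡ Star.c₁ st ⊎ h₁ ≡ Star.c₂ st → h₂ ≡ Star.c₁ st ⊎ h₂ ≡ Star.c₂ st →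
         side t h₁ u ⊎ side t h₂ u
    go (inj₁ s₁) (inj₁ refl) _          = inj₁ s₁
    go (inj₁ s₁) (inj₂ refl) (inj₁ refl) = inj₂ s₁
    go (inj₁ s₁) (inj₂ refl) (inj₂ refl) = ⊥-elim (ne refl)
    go (inj₂ s₂) (inj₂ refl) _          = inj₁ s₂
    go (inj₂ s₂) (inj₁ refl) (inj₂ refl) = inj₂ s₂
    go (inj₂ s₂) (inj₁ refl) (inj₁ refl) = ⊥-elim (ne refl)

  other-child : ∀ {t h} → Inner T t → Away t h → Σ (Fin m) λ c → Away t c × c ≢ h
  other-child {t} {h} inn ath = pick (child-of-star awp st ath)
    where
    awp : Away (parent t) t
    awp = away-parent (inner≢x inn)
    st : Star t (parent t)
    st = star inn awp
    pick : h ≡ Star.c₁ st ⊎ h ≡ Star.c₂ st → Σ (Fin m) λ c → Away t c × c ≢ h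
    pick (inj₁ e) = Star.c₂ st , Star.away₂ st , λ c₂≡h → Star.c₁≢c₂ st (trans (sym e) (sym c₂≡h))
    pick (inj₂ e) = Star.c₁ st , Star.away₁ st , λ c₁≡h → Star.c₁≢c₂ st (trans c₁≡h e)

  sibling : Fin m → Fin m → Fin m
  sibling t h with any? (λ c → Away? t c ×-dec ¬? (c ≟F h))
  ... | yes (c , _) = c
  ... | no _        = h

  sibling-spec : ∀ {t h} → Inner T t → Away t h → Away t (sibling t h) × sibling t h ≢ h
  sibling-spec {t} {h} inn ath with any? (λ c → Away? t c ×-dec ¬? (c ≟F h))
  ... | yes (c , r) = r
  ... | no none     = ⊥-elim (none (other-child inn ath))

  sibling-unique : ∀ {t h c} → Inner T t → Away t h → Away t c → c ≢ h → sibling t h ≡ c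
  sibling-unique {t} {h} {c} inn ath ac c≢h =
    twoChildren (child-of-star awp st (proj₁ sib)) (child-of-star awp st ac) (child-of-star awp st ath)
      (proj₂ sib) c≢h
    where
    awp : Away (parent t) t
    awp = away-parent (inner≢x inn)
    st : Star t (parent t)
    st = star inn awp
    sib : Away t (sibling t h) × sibling t h ≢ h
    sib = sibling-spec inn ath
    twoChildren : ∀ {c₁ c₂ s c h : Fin m} → s ≡ c₁ ⊎ s ≡ c₂ → c ≡ c₁ ⊎ c ≡ c₂ → h ≡ c₁ ⊎ h ≡ c₂ →
      s ≢ h → c ≢ h → s ≡ c
    twoChildren (inj₁ refl) (inj₁ refl) _ _ _ = refl
    twoChildren (inj₂ refl) (inj₂ refl) _ _ _ = refl
    twoChildren (inj₁ refl) (inj₂ refl) (inj₁ refl) n₁ _ = ⊥-elim (n₁ refl)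
    twoChildren (inj₁ refl) (inj₂ refl) (inj₂ refl) _ n₂ = ⊥-elim (n₂ refl)
    twoChildren (inj₂ refl) (inj₁ refl) (inj₁ refl) _ n₂ = ⊥-elim (n₂ refl)
    twoChildren (inj₂ refl) (inj₁ refl) (inj₂ refl) n₁ _ = ⊥-elim (n₁ refl)

  sideᵇ : Fin m → Fin m → Fin m → Bool
  sideᵇ t h u with adj T t h ≟B true
  ... | no _ = false
  ... | yes th with side-cover th u
  ...   | inj₁ _ = true
  ...   | inj₂ _ = false

  sideᵇ-sound : ∀ t h u → sideᵇ t h u ≡ true → side t h u
  sideᵇ-sound t h u e with adj T t h ≟B true
  ... | no _ = ⊥-elim (true≢false (sym e))
  ... | yes th with side-cover th u
  ...   | inj₁ s = s
  ...   | inj₂ _ = ⊥-elim (true≢false (sym e))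

  sideᵇ-complete : ∀ {t h u} → Adj T t h → side t h u → sideᵇ t h u ≡ true
  sideᵇ-complete {t} {h} {u} th s with adj T t h ≟B true
  ... | no ¬th = ⊥-elim (¬th th)
  ... | yes th′ with side-cover th′ u
  ...   | inj₁ _  = refl
  ...   | inj₂ s′ = ⊥-elim (side-disjoint th s s′)

  size : Fin m → Fin m → ℕ
  size t h = countΣ (sideᵇ t h)

  size-< : ∀ {p t h} → Away p t → Away t h → size t h < size p t
  size-< {p} {t} {h} ap ath =
    countΣ-strict (sideᵇ t h) (sideᵇ p t)
      (λ u e → sideᵇ-complete (proj₁ ap) (side-⊆ ap ath (sideᵇ-sound t h u e))) t
      (¬-not (tail∉side (proj₁ ath) ∘ sideᵇ-sound t h t))
      (sideᵇ-complete (proj₁ ap) here)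

  subtree : Fin m → ℕ
  subtree v = size (parent v) v

  subtree-away : ∀ {t h} → Away t h → subtree h ≡ size t h
  subtree-away a = cong (λ q → size q _) (parent-spec a)

  subtree-< : ∀ {t h} → Inner T t → Away t h → subtree h < subtree t
  subtree-< inn ath rewrite subtree-away ath = size-< (away-parent (inner≢x inn)) ath

  subtree-≤ : ∀ v → subtree v ≤ m
  subtree-≤ v = countΣ-≤ (sideᵇ (parent v) v)

  -- Every side contains a leaf (descend to a child until a leaf is hit).
  leaf-below : ∀ {t h} → Away t h → Σ (Fin m) λ l → Leaf T l × side t h l
  leaf-below {t} {h} ath = go (suc (size t h)) ath ≤-refl
    where
    go : ∀ N {t h} → Away t h → size t h < N → Σ (Fin m) λ l → Leaf T l × side t h l
    go (suc N) {t} {h} ath lt with deg T h ≟ℕ 1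
    ... | yes lh = h , lh , here
    ... | no inn with Star.away₁ (star inn ath)
    ...   | ac with go N ac (≤-trans (size-< ath ac) (≤-pred lt))
    ...     | l , ll , s = l , ll , side-⊆ ath ac s

  v₀ : Fin m
  v₀ = proj₁ (countΣ-witness (adj T x) leafX)

  x-v₀ : Adj T x v₀
  x-v₀ = proj₂ (countΣ-witness (adj T x) leafX)

  away-root : Away x v₀
  away-root = x-v₀ , tail∉side x-v₀

  v₀-leaf : Leaf T v₀ → ∀ w → w ≡ x ⊎ w ≡ v₀
  v₀-leaf lv w = go (connT x w tt tt) (inj₁ refl)
    where
    go : ∀ {c} → Walk (Edge AllV (Adj T)) c w → c ≡ x ⊎ c ≡ v₀ → w ≡ x ⊎ w ≡ v₀
    go here q = q
    go (step (_ , _ , e) r) (inj₁ refl) = go r (inj₂ (leaf-neighbour leafX e x-v₀))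
    go (step (_ , _ , e) r) (inj₂ refl) = go r (inj₁ (leaf-neighbour lv e (T-sym x-v₀)))

module WidthOne {n} (G : Graph n) (connG : Connected G) (D : RankDecomp G) (width : WidthLE D 1)
  (x : Fin (RankDecomp.m D)) (leafX : Leaf (RankDecomp.T D) x)
  (U : Fin (RankDecomp.m D) → Fin (RankDecomp.m D) → Fin n → Bool)
  (adm : Admissible G (RankDecomp.T D) (RankDecomp.L D) x U)
  (P : Fin (RankDecomp.m D) → Fin (RankDecomp.m D) → Fin n → Fin n → Bool)
  (isP : IsPMatrix G (RankDecomp.T D) (RankDecomp.L D) x U P) where

  open RankDecomp D
  open OrientedTree T (proj₁ (proj₂ (proj₁ subcubic))) (proj₂ (proj₂ (proj₁ subcubic)))
    (proj₂ (proj₂ subcubic)) x leafX public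

  A : Fin m → Fin m → Fin n → Set
  A t h a = side t h (L a)

  A? : ∀ {t h} → Away t h → ∀ a → Dec (A t h a)
  A? aw a = side? (proj₁ aw) (L a)

  U⊆A : ∀ {t h} → Away t h → ∀ a → U t h a ≡ true → A t h a
  U⊆A {t} {h} aw = proj₁ (proj₁ adm t h aw)

  U-spans : ∀ {t h} → Away t h → ∀ a → A t h a → Σ (Fin n → Bool) λ S →
    (∀ b → S b ≡ true → U t h b ≡ true) ×
    (∀ c → ¬ A t h c → adj G a c ≡ xorΣ (λ b → S b ∧ adj G b c))
  U-spans {t} {h} aw = proj₁ (proj₂ (proj₁ adm t h aw))

  U-independent : ∀ {t h} → Away t h → ∀ (S : Fin n → Bool) → (∀ b → S b ≡ true → U t h b ≡ true) →
    (∀ c → ¬ A t h c → xorΣ (λ b → S b ∧ adj G b c) ≡ false) → ∀ b → S b ≡ false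
  U-independent {t} {h} aw = proj₂ (proj₂ (proj₁ adm t h aw))

  rows-multiples : ∀ {t h} → Away t h → Σ (Fin n → Bool) λ ω → ∀ a → A t h a →
    Σ Bool λ β → ∀ c → ¬ A t h c → adj G a c ≡ β ∧ ω c
  rows-multiples {t} {h} aw with width t h (proj₁ aw)
  ... | zero , ((w , f) , _) , _ = (λ _ → false) , λ a Aa → false , λ c Bc → proj₂ (f a Aa) c Bc
  ... | suc zero , ((w , f) , _) , _ =
        w zero , λ a Aa → proj₁ (f a Aa) zero , λ c Bc → trans (proj₂ (f a Aa) c Bc) (xor-identityʳ _)
  ... | suc (suc r) , _ , s≤s ()

  -- A row indexed by U_e is nonzero (a zero row is linearly dependent).
  U-row-nonzero : ∀ {t h b} → Away t h → U t h b ≡ true → ¬ (∀ c → ¬ A t h c → adj G b c ≡ false)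
  U-row-nonzero {t} {h} {b} aw ub zero-row =
    true≢false (trans (sym (δ-refl b)) (U-independent aw (δ b) δb⊆U
      (λ c Bc → trans (xorΣ-δ b (λ b′ → adj G b′ c)) (zero-row c Bc)) b))
    where
    δb⊆U : ∀ b′ → δ b b′ ≡ true → U t h b′ ≡ true
    δb⊆U b′ e = subst (λ q → U t h q ≡ true) (δ-true e) ub

  U-row-witness : ∀ {t h b} → Away t h → U t h b ≡ true → Σ (Fin n) λ c → ¬ A t h c × Adj G b c
  U-row-witness {t} {h} {b} aw ub with any? (λ c → ¬? (A? aw c) ×-dec (adj G b c ≟B true))
  ... | yes r   = r
  ... | no none = ⊥-elim (U-row-nonzero aw ub (λ c Bc → ¬-not (λ e → none (c , Bc , e))))

  -- Width 1 makes U_e a singleton: two distinct rows that are both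
  -- nonzero multiples of ω sum to zero.
  U-singleton : ∀ {t h b₁ b₂} → Away t h → U t h b₁ ≡ true → U t h b₂ ≡ true → b₁ ≡ b₂
  U-singleton {t} {h} {b₁} {b₂} aw u₁ u₂ with b₁ ≟F b₂
  ... | yes e = e
  ... | no ne = equalRows (proj₁ r₁) (proj₁ r₂) (proj₂ r₁) (proj₂ r₂)
    where
    ω : Fin n → Bool
    ω = proj₁ (rows-multiples aw)
    r₁ : Σ Bool λ β → ∀ c → ¬ A t h c → adj G b₁ c ≡ β ∧ ω c
    r₁ = proj₂ (rows-multiples aw) b₁ (U⊆A aw b₁ u₁)
    r₂ : Σ Bool λ β → ∀ c → ¬ A t h c → adj G b₂ c ≡ β ∧ ω c
    r₂ = proj₂ (rows-multiples aw) b₂ (U⊆A aw b₂ u₂)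
    S : Fin n → Bool
    S b = δ b₁ b xor δ b₂ b
    S-b₁ : S b₁ ≡ true
    S-b₁ = cong₂ _xor_ (δ-refl b₁) (δ-false (ne ∘ sym))
    S⊆U : ∀ b → S b ≡ true → U t h b ≡ true
    S⊆U b e with δ b₁ b in d₁
    ... | true  = subst (λ q → U t h q ≡ true) (δ-true d₁) u₁
    ... | false = subst (λ q → U t h q ≡ true) (δ-true e) u₂
    equalRows : ∀ β₁ β₂ → (∀ c → ¬ A t h c → adj G b₁ c ≡ β₁ ∧ ω c) →
      (∀ c → ¬ A t h c → adj G b₂ c ≡ β₂ ∧ ω c) → b₁ ≡ b₂
    equalRows false _     e₁ _  = ⊥-elim (U-row-nonzero aw u₁ e₁)
    equalRows true  false _  e₂ = ⊥-elim (U-row-nonzero aw u₂ e₂)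
    equalRows true  true  e₁ e₂ = ⊥-elim (true≢false (trans (sym S-b₁) (U-independent aw S S⊆U sumZero b₁)))
      where
      sumZero : ∀ c → ¬ A t h c → xorΣ (λ b → S b ∧ adj G b c) ≡ false
      sumZero c Bc = begin
          xorΣ (λ b → S b ∧ adj G b c)
        ≡⟨ xorΣ-cong (λ b → ∧-distribʳ-xor (adj G b c) (δ b₁ b) (δ b₂ b)) ⟩
          xorΣ (λ b → (δ b₁ b ∧ adj G b c) xor (δ b₂ b ∧ adj G b c))
        ≡⟨ xorΣ-xor (λ b → δ b₁ b ∧ adj G b c) (λ b → δ b₂ b ∧ adj G b c) ⟩
          xorΣ (λ b → δ b₁ b ∧ adj G b c) xor xorΣ (λ b → δ b₂ b ∧ adj G b c)
        ≡⟨ cong₂ _xor_ (xorΣ-δ b₁ (λ b → adj G b c)) (xorΣ-δ b₂ (λ b → adj G b c)) ⟩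
          adj G b₁ c xor adj G b₂ c
        ≡⟨ cong₂ _xor_ (e₁ c Bc) (e₂ c Bc) ⟩
          ω c xor ω c
        ≡⟨ xor-same (ω c) ⟩
          false ∎
        where open ≡-Reasoning

  U-is-δ : ∀ {t h b} → Away t h → U t h b ≡ true → ∀ b′ → U t h b′ ≡ δ b b′
  U-is-δ {t} {h} {b} aw ub b′ with U t h b′ in e
  ... | true  = sym (subst (λ q → δ b q ≡ true) (U-singleton aw ub e) (δ-refl b))
  ... | false = sym (¬-not λ d → true≢false (trans (sym (subst (λ q → U t h q ≡ true) (δ-true d) ub)) e))

  P-identity : ∀ {t h b a c} → Away t h → U t h b ≡ true → A t h a → ¬ A t h c →
    adj G a c ≡ P t h a b ∧ adj G b c
  P-identity {t} {h} {b} {a} {c} aw ub Aa Bc =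
    trans (isP t h aw a Aa c Bc)
      (trans (xorΣ-cong (λ b′ → cong (_∧ (P t h a b′ ∧ adj G b′ c)) (U-is-δ aw ub b′)))
             (xorΣ-δ b (λ b′ → P t h a b′ ∧ adj G b′ c)))

  -- the vertex of G at the leaf x; it lies outside every A_e
  b₀ : Fin n
  b₀ = proj₁ (L-onto x leafX)

  -- Since G is connected, some edge of G crosses every cut with A_e ≠ ∅.
  crossing-edge : ∀ {t h} → Away t h → ∀ a₀ → A t h a₀ →
    Σ (Fin n) λ a → Σ (Fin n) λ c → A t h a × ¬ A t h c × Adj G a c
  crossing-edge {t} {h} aw a₀ A₀ = go (connG a₀ b₀ tt tt) A₀
    where
    B₀ : ¬ A t h b₀
    B₀ s = proj₂ aw (subst (side t h) (proj₂ (L-onto x leafX)) s)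
    go : ∀ {s} → Walk (Edge AllV (Adj G)) s b₀ → A t h s →
      Σ (Fin n) λ a → Σ (Fin n) λ c → A t h a × ¬ A t h c × Adj G a c
    go here As = ⊥-elim (B₀ As)
    go {s} (step {v = s′} (_ , _ , e) r) As with A? aw s′
    ... | yes As′ = go r As′
    ... | no Bs′  = s , s′ , As , Bs′ , e

  -- Hence M_e ≠ 0 and U_e is nonempty.
  U-nonempty : ∀ {t h} → Away t h → Σ (Fin n) λ b → U t h b ≡ true
  U-nonempty {t} {h} aw with leaf-below aw
  ... | l , leafL , s with L-onto l leafL
  ...   | a₀ , refl with crossing-edge aw a₀ s
  ...     | a , c , Aa , Bc , ac with U-spans aw a Aa
  ...       | S , S⊆U , row with xorΣ-witness _ (trans (sym (row c Bc)) ac)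
  ...         | b , Sb = b , S⊆U b (∧-conicalˡ (S b) _ Sb)

  u : Fin m → Fin m → Fin n
  u t h with any? (λ a → U t h a ≟B true)
  ... | yes (a , _) = a
  ... | no _        = b₀

  u∈U : ∀ {t h} → Away t h → U t h (u t h) ≡ true
  u∈U {t} {h} aw with any? (λ a → U t h a ≟B true)
  ... | yes (a , e) = e
  ... | no none     = ⊥-elim (none (U-nonempty aw))

  u-unique : ∀ {t h a} → Away t h → U t h a ≡ true → u t h ≡ a
  u-unique aw ua = U-singleton aw (u∈U aw) ua

  selected : Fin m → Fin n → Bool
  selected v a = P (parent v) v a (u (parent v) v)

  selected-at : ∀ {t v a a′} → Away t v → U t v a ≡ true → selected v a′ ≡ P t v a′ a
  selected-at {t} {v} {a} {a′} aw ua rewrite parent-spec aw | u-unique aw ua = refl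

  module Block {v h₁ h₂ a₁ a₂} (innerV : Inner T v) (aw₁ : Away v h₁) (aw₂ : Away v h₂)
    (h₁≢h₂ : h₁ ≢ h₂) (ua₁ : U v h₁ a₁ ≡ true) (ua₂ : U v h₂ a₂ ≡ true) where

    p : Fin m
    p = parent v

    awIn : Away p v
    awIn = away-parent (inner≢x innerV)

    uᵢₙ : Fin n
    uᵢₙ = u p v

    uᵢₙ∈U : U p v uᵢₙ ≡ true
    uᵢₙ∈U = u∈U awIn

    below : ∀ {h a} → Away v h → A v h a → A p v a
    below awh = side-⊆ awIn awh

    A₁ : A v h₁ a₁
    A₁ = U⊆A aw₁ a₁ ua₁

    A₂ : A v h₂ a₂
    A₂ = U⊆A aw₂ a₂ ua₂

    L≢v : ∀ d → L d ≢ v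
    L≢v d e = innerV (subst (Leaf T) e (L-leaf d))

    -- An edge of G from below vh to B_{pv} forces u_{vh} to be selected:
    -- by P_{vh} the edge is seen by u_{vh}, then by P_{pv} u_{vh} is selected.
    forcesSelected : ∀ {h b a c} → Away v h → U v h b ≡ true → A v h a → ¬ A p v c → Adj G a c →
      selected v b ≡ true
    forcesSelected {b = b} {c = c} awh ub Aa Bc ac =
      ∧-conicalˡ _ _ (trans (sym (P-identity awIn uᵢₙ∈U (below awh (U⊆A awh b ub)) Bc)) bc)
      where
      bc : Adj G b c
      bc = ∧-conicalʳ _ _ (trans (sym (P-identity awh ub Aa (Bc ∘ below awh))) ac)

    -- At least one of a₁, a₂ is selected: some edge of G crosses the cut pv,
    -- and it starts below vh₁ or below vh₂.
    someSelected : selected v a₁ ≡ false → selected v a₂ ≡ false → ⊥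
    someSelected s₁ s₂ with crossing-edge awIn a₁ (below aw₁ A₁)
    ... | a , c , Aa , Bc , ac with children-cover awIn innerV aw₁ aw₂ h₁≢h₂ Aa (L≢v a)
    ...   | inj₁ S₁ = true≢false (trans (sym (forcesSelected aw₁ ua₁ S₁ Bc ac)) s₁)
    ...   | inj₂ S₂ = true≢false (trans (sym (forcesSelected aw₂ ua₂ S₂ Bc ac)) s₂)

    -- An unselected a₁ is adjacent to a₂: the nonzero row of a₁ must be
    -- witnessed inside A_{pv}, hence below vh₂, where only a₂ sees a₁.
    unselected-adjacent : selected v a₁ ≡ false → Adj G a₁ a₂
    unselected-adjacent s₁ with U-row-witness aw₁ ua₁
    ... | d , Bd , a₁d with A? awIn d
    ...   | no B′d = ⊥-elim (true≢false (trans (sym (forcesSelected aw₁ ua₁ A₁ B′d a₁d)) s₁))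
    ...   | yes A′d with children-cover awIn innerV aw₁ aw₂ h₁≢h₂ A′d (L≢v d)
    ...     | inj₁ S₁ = ⊥-elim (Bd S₁)
    ...     | inj₂ S₂ = trans (adj-sym G a₁ a₂)
                (∧-conicalʳ _ _ (trans (sym (P-identity aw₂ ua₂ S₂ (distinctSides (proj₁ aw₁) (proj₁ aw₂) h₁≢h₂ A₁)))
                                       (trans (adj-sym G d a₁) a₁d)))

module Expansion {n} (G : Graph n) (connG : Connected G) (bipartite : Bipartite G) (n≥3 : 3 ≤ n)
  (D : RankDecomp G) (width : WidthLE D 1)
  (x : Fin (RankDecomp.m D)) (leafX : Leaf (RankDecomp.T D) x)
  (U : Fin (RankDecomp.m D) → Fin (RankDecomp.m D) → Fin n → Bool)
  (adm : Admissible G (RankDecomp.T D) (RankDecomp.L D) x U)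
  (P : Fin (RankDecomp.m D) → Fin (RankDecomp.m D) → Fin n → Fin n → Bool)
  (isP : IsPMatrix G (RankDecomp.T D) (RankDecomp.L D) x U P) where

  open RankDecomp D
  open WidthOne G connG D width x leafX U adm P isP

  -- Two selected vertices of a block are not adjacent in G: both see the
  -- witness c of the nonzero row of uᵢₙ, and G has no triangle.
  selected-nonadjacent : ∀ {v h₁ h₂ a₁ a₂} → Inner T v → Away v h₁ → Away v h₂ → h₁ ≢ h₂ →
    U v h₁ a₁ ≡ true → U v h₂ a₂ ≡ true → selected v a₁ ≡ true → selected v a₂ ≡ true → ¬ Adj G a₁ a₂
  selected-nonadjacent {v} {a₁ = a₁} {a₂} innerV aw₁ aw₂ h₁≢h₂ ua₁ ua₂ s₁ s₂ a₁a₂ =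
    triangle (U-row-witness awIn uᵢₙ∈U)
    where
    open Block innerV aw₁ aw₂ h₁≢h₂ ua₁ ua₂
    colour : Fin n → Bool
    colour = proj₁ bipartite
    proper : ∀ a b → Adj G a b → colour a ≢ colour b
    proper = proj₂ bipartite
    triangle : Σ (Fin n) (λ c → ¬ A p v c × Adj G uᵢₙ c) → ⊥
    triangle (c , Bc , uc) =
      noThreeDistinct (colour a₁) (colour a₂) (colour c) (proper a₁ c a₁c) (proper a₂ c a₂c) (proper a₁ a₂ a₁a₂)
      where
      a₁c : Adj G a₁ c
      a₁c = trans (P-identity awIn uᵢₙ∈U (below aw₁ A₁) Bc) (cong₂ _∧_ s₁ uc)
      a₂c : Adj G a₂ c
      a₂c = trans (P-identity awIn uᵢₙ∈U (below aw₂ A₂) Bc) (cong₂ _∧_ s₂ uc)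

  Vertex : Set
  Vertex = RVert G T L x

  InR′ : Vertex → Set
  InR′ = InR G T L x U P

  REdge′ : Vertex → Vertex → Set
  REdge′ = REdge G T L x U P

  level : Bool → ℕ
  level true  = 2
  level false = 1

  -- Potential: the block S_v occupies the levels 4·|T_v| + 1 … 4·|T_v| + 3,
  -- where |T_v| is the size of the subtree at v; in it the copy of the
  -- incoming edge is at level 3, selected outgoing copies at level 2 and
  -- unselected ones at level 1.
  Ψ : Vertex → ℕ
  Ψ (rv a t h v) with v ≟F h
  ... | yes _ = 4 * subtree h + 3
  ... | no _  = 4 * subtree t + level (selected t a)

  incomingCopy : Fin m → Vertex
  incomingCopy v = rv (u (parent v) v) (parent v) v v

  siblingCopy : Fin m → Fin m → Vertex
  siblingCopy t h = rv (u t (sibling t h)) t (sibling t h) t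

  tailParent : Fin n → Fin m → Fin m → Vertex
  tailParent a t h = if selected t a then incomingCopy t else siblingCopy t h

  par : Vertex → Vertex
  par (rv a t h v) with v ≟F h
  ... | yes _ = rv a t h t
  ... | no _  = tailParent a t h

  Ψ-head : ∀ a t h → Ψ (rv a t h h) ≡ 4 * subtree h + 3
  Ψ-head a t h with h ≟F h
  ... | yes _ = refl
  ... | no ne = ⊥-elim (ne refl)

  Ψ-tail : ∀ a t h → t ≢ h → Ψ (rv a t h t) ≡ 4 * subtree t + level (selected t a)
  Ψ-tail a t h t≢h with t ≟F h
  ... | yes e = ⊥-elim (t≢h e)
  ... | no _  = refl

  par-head : ∀ a t h → par (rv a t h h) ≡ rv a t h t
  par-head a t h with h ≟F h
  ... | yes _ = refl
  ... | no ne = ⊥-elim (ne refl)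

  par-tail : ∀ a t h → t ≢ h → par (rv a t h t) ≡ tailParent a t h
  par-tail a t h t≢h with t ≟F h
  ... | yes e = ⊥-elim (t≢h e)
  ... | no _  = refl

  Ψ-bound : ∀ y → Ψ y < 4 * m + 4
  Ψ-bound (rv a t h v) with v ≟F h
  ... | yes _ = ≤-<-trans (+-monoˡ-≤ 3 (*-monoʳ-≤ 4 (subtree-≤ h))) (+-monoʳ-< (4 * m) ≤-refl)
  ... | no _  = ≤-<-trans (+-mono-≤ (*-monoʳ-≤ 4 (subtree-≤ t)) (level≤3 (selected t a))) (+-monoʳ-< (4 * m) ≤-refl)
    where
    level≤3 : ∀ b → level b ≤ 3
    level≤3 true  = s≤s (s≤s z≤n)
    level≤3 false = s≤s z≤n

  block-gap : ∀ {a b} → a < b → ∀ k → 4 * a + 3 < 4 * b + k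
  block-gap {a} {b} lt k = ≤-trans arith (≤-trans (*-monoʳ-≤ 4 lt) (m≤m+n (4 * b) k))
    where
    arith : suc (4 * a + 3) ≤ 4 * suc a
    arith rewrite *-suc 4 a | +-comm (4 * a) 3 = ≤-refl

  away≢ : ∀ {t h} → Away t h → t ≢ h
  away≢ aw refl = T-irrefl (proj₁ aw)

  open PotentialTree InR′ REdge′ Ψ par

  headToTail : ∀ {a t h} → Inner T t → Away t h → ToParent (rv a t h h) (rv a t h t)
  headToTail {a} {t} {h} innerT aw rewrite Ψ-head a t h | Ψ-tail a t h (away≢ aw) | par-head a t h =
    block-gap (subtree-< innerT aw) _ , refl

  incomingCopy-at : ∀ {a t v} → Away t v → U t v a ≡ true → incomingCopy v ≡ rv a t v v
  incomingCopy-at {a} {t} {v} aw ua =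
    trans (cong (λ q → rv (u q v) q v v) (parent-spec aw)) (cong (λ q → rv q t v v) (u-unique aw ua))

  siblingCopy-at : ∀ {t h h′ a} → Inner T t → Away t h → Away t h′ → h ≢ h′ → U t h a ≡ true →
    siblingCopy t h′ ≡ rv a t h t
  siblingCopy-at innerT aw aw′ h≢h′ ua =
    trans (cong (λ q → rv (u _ q) _ q _) (sibling-unique innerT aw′ aw h≢h′))
          (cong (λ q → rv q _ _ _) (u-unique aw ua))

  Ψ-tailAt : ∀ {a t h b} → t ≢ h → selected t a ≡ b → Ψ (rv a t h t) ≡ 4 * subtree t + level b
  Ψ-tailAt {a} {t} {h} t≢h refl = Ψ-tail a t h t≢h

  selectedToHead : ∀ {a t v a′ h′} → Away t v → U t v a ≡ true → Away v h′ → P t v a′ a ≡ true →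
    ToParent (rv a′ v h′ v) (rv a t v v)
  selectedToHead {a} {t} {v} {a′} {h′} aw ua aw′ pe =
    subst₂ _<_ (sym (Ψ-tailAt (away≢ aw′) sel)) (sym (Ψ-head a t v)) (+-monoʳ-< (4 * subtree v) ≤-refl) ,
    sym parentIs
    where
    sel : selected v a′ ≡ true
    sel = trans (selected-at aw ua) pe
    parentIs : par (rv a′ v h′ v) ≡ rv a t v v
    parentIs = begin
        par (rv a′ v h′ v)  ≡⟨ par-tail a′ v h′ (away≢ aw′) ⟩
        tailParent a′ v h′  ≡⟨ cong (if_then incomingCopy v else siblingCopy v h′) sel ⟩
        incomingCopy v      ≡⟨ incomingCopy-at aw ua ⟩
        rv a t v v          ∎
      where open ≡-Reasoning

  unselectedToSibling : ∀ {v h h′ a a′} → Inner T v → Away v h → Away v h′ → h ≢ h′ → U v h a ≡ true →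
    selected v a ≡ true → selected v a′ ≡ false → ToParent (rv a′ v h′ v) (rv a v h v)
  unselectedToSibling {v} {h} {h′} {a} {a′} innerV aw aw′ h≢h′ ua s s′ =
    subst₂ _<_ (sym (Ψ-tailAt (away≢ aw′) s′)) (sym (Ψ-tailAt (away≢ aw) s)) (+-monoʳ-< (4 * subtree v) ≤-refl) ,
    sym parentIs
    where
    parentIs : par (rv a′ v h′ v) ≡ rv a v h v
    parentIs = begin
        par (rv a′ v h′ v)  ≡⟨ par-tail a′ v h′ (away≢ aw′) ⟩
        tailParent a′ v h′  ≡⟨ cong (if_then incomingCopy v else siblingCopy v h′) s′ ⟩
        siblingCopy v h′    ≡⟨ siblingCopy-at innerV aw aw′ h≢h′ ua ⟩
        rv a v h v          ∎
      where open ≡-Reasoning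

  -- edges of type (a) join a head copy to its tail copy, type (b) a selected
  -- copy to the incoming copy, type (c) an unselected copy to its sibling
  rawEdge-parent : ∀ y z → InR′ y → InR′ z → RawEdge G T L x U P y z → ToParent y z ⊎ ToParent z y
  rawEdge-parent (rv _ _ _ v) (rv _ _ _ v′) (_ , _ , v∈th , _) (_ , _ , v′∈th , _)
                 (inj₁ (refl , refl , refl , v≢v′)) with v∈th | v′∈th
  ... | inj₁ refl | inj₁ refl = ⊥-elim (v≢v′ refl)
  ... | inj₂ refl | inj₂ refl = ⊥-elim (v≢v′ refl)
  rawEdge-parent _ _ (_ , aw , _ , _) (innerT , _ , _ , _) _ | inj₂ refl | inj₁ refl = inj₁ (headToTail innerT aw)
  rawEdge-parent _ _ (innerT , aw , _ , _) _ _             | inj₁ refl | inj₂ refl = inj₂ (headToTail innerT aw)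
  rawEdge-parent _ _ (_ , aw , _ , ua) (_ , aw′ , _ , _)
                 (inj₂ (inj₁ (refl , refl , refl , pe))) = inj₂ (selectedToHead aw ua aw′ pe)
  rawEdge-parent (rv a _ _ v) (rv a′ _ _ _) (innerV , aw , _ , ua) (_ , aw′ , _ , ua′)
                 (inj₂ (inj₂ (refl , refl , refl , h≢h′ , aa′))) with selected v a in s | selected v a′ in s′
  ... | true  | true  = ⊥-elim (selected-nonadjacent innerV aw aw′ h≢h′ ua ua′ s s′ aa′)
  ... | false | false = ⊥-elim (Block.someSelected innerV aw aw′ h≢h′ ua ua′ s s′)
  ... | true  | false = inj₂ (unselectedToSibling innerV aw aw′ h≢h′ ua s s′)
  ... | false | true  = inj₁ (unselectedToSibling innerV aw′ aw (h≢h′ ∘ sym) ua′ s′ s)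

  parentEdges : ParentEdges
  parentEdges y z (iy , iz , inj₁ r) = rawEdge-parent y z iy iz r
  parentEdges y z (iy , iz , inj₂ r) = ⊎-swap (rawEdge-parent z y iz iy r)

  root : Vertex
  root = rv (u x v₀) x v₀ v₀

  -- v₀ is inner since G has at least three vertices, so root is a vertex.
  root∈R : InR′ root
  root∈R = innerV₀ , away-root , inj₂ refl , u∈U away-root
    where
    innerV₀ : Inner T v₀
    innerV₀ leafV₀ = noInjectionIntoPair n≥3 L (λ i → v₀-leaf leafV₀ (L i)) L-inj

  climb : Climbs root
  climb (rv a t h _) (_ , aw , inj₂ refl , ua) with deg T t ≟ℕ 1
  ... | yes leafT with away-from-leaf leafT aw
  ...   | refl with leaf-neighbour leafX (proj₁ aw) x-v₀
  ...     | refl = inj₁ (cong (λ q → rv q x v₀ v₀) (sym (u-unique aw ua)))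
  climb (rv a t h _) (_ , aw , inj₂ refl , ua) | no innerT =
    inj₂ (_ , (innerT , aw , inj₁ refl , ua) , inj₁ (inj₁ (refl , refl , refl , away≢ aw ∘ sym)) ,
          headToTail innerT aw)
  climb (rv a t h _) (innerT , aw , inj₁ refl , ua) with selected t a in s
  ... | true = inj₂ (_ , (innerT , awIn , inj₂ refl , u∈U awIn) , inj₂ (inj₂ (inj₁ (refl , refl , refl , s))) ,
                     selectedToHead awIn (u∈U awIn) aw s)
    where
    awIn : Away (parent t) t
    awIn = away-parent (inner≢x innerT)
  ... | false = inj₂ (_ , (innerT , awS , inj₁ refl , u∈U awS) ,
                      inj₁ (inj₂ (inj₂ (refl , refl , refl , h≢s , unselected-adjacent s))) ,
                      unselectedToSibling innerT awS aw (h≢s ∘ sym) (u∈U awS) sib-selected s)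
    where
    awS : Away t (sibling t h)
    awS = proj₁ (sibling-spec innerT aw)
    h≢s : h ≢ sibling t h
    h≢s = proj₂ (sibling-spec innerT aw) ∘ sym
    open Block innerT aw awS h≢s ua (u∈U awS)
    sib-selected : selected t (u t (sibling t h)) ≡ true
    sib-selected = ¬-not (someSelected s)

  isTree : RankExpansionIsTree G T L x U P
  isTree = potentialTree (λ { (inj₁ r) → inj₂ r ; (inj₂ r) → inj₁ r }) root root∈R (4 * m + 4) Ψ-bound
             climb parentEdges

lemma4p4 : ∀ {n} (G : Graph n) → Connected G → Bipartite G → 3 ≤ n →
    RankWidthIs G 1 → (D : RankDecomp G) → WidthIs D 1 →
    (x : Fin (RankDecomp.m D)) → Leaf (RankDecomp.T D) x →
    (U : Fin (RankDecomp.m D) → Fin (RankDecomp.m D) → Fin n → Bool) →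
    Admissible G (RankDecomp.T D) (RankDecomp.L D) x U →
    (P : Fin (RankDecomp.m D) → Fin (RankDecomp.m D) → Fin n → Fin n → Bool) →
    IsPMatrix G (RankDecomp.T D) (RankDecomp.L D) x U P →
    RankExpansionIsTree G (RankDecomp.T D) (RankDecomp.L D) x U P
lemma4p4 G connG bipartite n≥3 _ D widthD x leafX U adm P isP =
  Expansion.isTree G connG bipartite n≥3 D (proj₁ widthD) x leafX U adm P isP
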